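{- For every $\Delta$-institution $\mathcal{I}$, every infinite cardinal $\alpha$ and every signature $\Sigma$ of $\mathcal{I}$, we have ${\vdash^{\alpha\,\mathcal{I}}_{\Sigma}}\subseteq{\models^{\mathsf{FOL}_\alpha(\mathcal{I})}_{\Sigma}}$, i.e. whenever $\Gamma\vdash^{\alpha\,\mathcal{I}}_\Sigma\Delta$, no $\Sigma$-model satisfies (in $\mathsf{FOL}_\alpha(\mathcal I)$) every sentence of $\Gamma$ while satisfying no sentence of $\Delta$.
   Context: A $\Delta$-institution $\mathcal{I}$ consists of a locally small category $\mathsf{Sig}$ of signatures, a functor $\mathsf{Mod}:\mathsf{Sig}^{op}\to\mathbf{CAT}$, a functor $\mathsf{Sen}:\mathsf{Sig}\to\mathbf{Set}$, satisfaction relations $\models_\Sigma\subseteq|\mathsf{Mod}(\Sigma)|\times\mathsf{Sen}(\Sigma)$ with $\mathsf{Mod}(\chi)(\mathfrak{A}')\models\gamma$ iff $\mathfrak{A}'\models\mathsf{Sen}(\chi)(\gamma)$, together with a variable structure: (i) a functor $(\cdot)_\Delta:\mathsf{Sig}\to\mathbf{Cat}$ (objects of $\Sigma_\Delta$ are blocks for $\Sigma$); (ii) for each $\Sigma$ and $X\in|\Sigma_\Delta|$ a morphism $\Sigma(X):\Sigma\to\Sigma[X]$, and for $\iota:X\to Y$ in $\Sigma_\Delta$ a morphism $\Sigma[\iota]:\Sigma[X]\to\Sigma[Y]$ with $\Sigma[\iota]\circ\Sigma(X)=\Sigma(Y)$, functorial in $\iota$; (iii) for each $\chi:\Sigma\to\Sigma'$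 and $X$ a morphism $\chi[X]:\Sigma[X]\to\Sigma'[\chi_\Delta(X)]$ with $\chi[X]\circ\Sigma(X)=\Sigma'(\chi_\Delta(X))\circ\chi$, $\chi[Y]\circ\Sigma[\iota]=\Sigma'[\chi_\Delta(\iota)]\circ\chi[X]$, $\mathrm{id}_\Sigma[X]=\mathrm{id}$, $(\chi'\circ\chi)[X]=\chi'[\chi_\Delta(X)]\circ\chi[X]$; (iv) for all $\chi,X$ and $\tau:\Sigma'\to\Sigma''$, $\sigma:\Sigma[X]\to\Sigma''$ with $\sigma\circ\Sigma(X)=\tau\circ\chi$ there is a unique $u:\Sigma'[\chi_\Delta(X)]\to\Sigma''$ with $u\circ\Sigma'(\chi_\Delta(X))=\tau$, $u\circ\chi[X]=\sigma$; (v) for all $\chi:\Sigma\to\Sigma'$, $\mathfrak{A}'\in|\mathsf{Mod}(\Sigma')|$, $X$, and every $\Sigma(X)$-expansion $\hat{\mathfrak A}$ of $\mathsf{Mod}(\chi)(\mathfrak A')$ (a model of $\Sigma[X]$ whose $\mathsf{Mod}(\Sigma(X))$-reduct is $\mathsf{Mod}(\chi)(\mathfrak A')$) there is a unique $\Sigma'(\chi_\Delta(X))$-expansion $\hat{\mathfrak A}'$ of $\mathfrak A'$ with $\mathsf{Mod}(\chi[X])(\hat{\mathfrak A}')=\hat{\mathfrak A}$. A $\rho$-substitution, for $\rho:\Sigma\to\Sigma_1$, is a morphism $\theta:\Sigma_1\to\Sigma$ with $\theta\circ\rho=\mathrm{id}_\Sigma$. $\mathsf{FOL}_\alpha(\mathcal{I})$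 (for an infinite cardinal $\alpha$) has the same signatures, models and variable structure as $\mathcal I$; its sentence sets $\mathsf{Sen}^\alpha(\Sigma)$ are generated recursively by: atomic sentences $\phi\in\mathsf{Sen}(\Sigma)$ (tagged as atomic); $\neg\phi$; $\vee\phi$ for a family $\phi:N\to\mathsf{Sen}^\alpha(\Sigma)$ with $N\in\alpha$; $\exists X\cdot\phi$ for $X\in|\Sigma_\Delta|$ and $\phi\in\mathsf{Sen}^\alpha(\Sigma[X])$. Translation along $\chi$: atomic via $\mathsf{Sen}(\chi)$, componentwise on $\neg,\vee$, and $\exists X\cdot\phi\mapsto\exists\chi_\Delta(X)\cdot\mathsf{Sen}^\alpha(\chi[X])(\phi)$. Satisfaction: atomic as in $\mathcal I$; $\mathfrak A\models\neg\phi$ iff $\mathfrak A\not\models\phi$; $\mathfrak A\models\vee\phi$ iff $\mathfrak A\models\phi_i$ for some $i$; $\mathfrak A\models\exists X\cdot\phi$ iff $\hat{\mathfrak A}\models\phi$ for some $\Sigma(X)$-expansion $\hat{\mathfrak A}$ of $\mathfrak A$. $\Gamma\models^{\mathsf{FOL}_\alpha(\mathcal I)}_\Sigma\Delta$ (for $\Gamma,\Delta\subseteq\mathsf{Sen}^\alpha(\Sigma)$) means no $\Sigma$-model satisfies all of $\Gamma$ and none of $\Delta$; $\models^{\mathcal I}_\Sigma$ is defined likewise for sets of atomic sentences. The syntactic sequent $\vdash^{\alpha\,\mathcal{I}}=\{\vdash_\Sigma\subseteq\mathcal P(\mathsf{Sen}^\alpha(\Sigma))\times\mathcal P(\mathsf{Sen}^\alpha(\Sigma))\}_\Sigma$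 is the smallest family of relations closed under the following rules (all sets arbitrary): Structural: (Modify) from $\Gamma\vdash_\Sigma\Delta$ infer $\Gamma'\vdash_{\Sigma'}\Delta'$ whenever $\chi:\Sigma\to\Sigma'$, $\Gamma'\supseteq\mathsf{Sen}^\alpha(\chi)(\Gamma)$, $\Delta'\supseteq\mathsf{Sen}^\alpha(\chi)(\Delta)$; (Init) $\{\psi\}\cup\Gamma\vdash_\Sigma\Delta\cup\{\psi\}$; (Cut) from $\Gamma\vdash_\Sigma\Delta\cup\{\psi\}$ and $\{\psi\}\cup\Gamma'\vdash_\Sigma\Delta'$ infer $\Gamma\cup\Gamma'\vdash_\Sigma\Delta\cup\Delta'$. (Atom) $\Gamma_b\cup\Gamma\vdash_\Sigma\Delta\cup\Delta_b$ whenever $\Gamma_b,\Delta_b$ are sets of atomic sentences with $\Gamma_b\models^{\mathcal I}_\Sigma\Delta_b$. ($\neg_L$) from $\Gamma\vdash_\Sigma\Delta\cup\{\phi\}$ infer $\{\neg\phi\}\cup\Gamma\vdash_\Sigma\Delta$; ($\neg_R$) from $\{\phi\}\cup\Gamma\vdash_\Sigma\Delta$ infer $\Gamma\vdash_\Sigma\Delta\cup\{\neg\phi\}$. ($\vee_L$) for $\phi:N\to\mathsf{Sen}^\alpha(\Sigma)$: from $\{\phi_n\}\cup\Gamma_n\vdash_\Sigma\Delta_n$ for all $n\in N$ infer $\{\vee\phi\}\cup\bigcup_n\Gamma_n\vdash_\Sigma\bigcup_n\Delta_n$; ($\vee_R$) from $\Gamma\vdash_\Sigma\Delta\cup\{\phi_n\}$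 for some $n\in N$ infer $\Gamma\vdash_\Sigma\Delta\cup\{\vee\phi\}$. ($\exists_L$) from $\{\phi\}\cup\mathsf{Sen}^\alpha(\Sigma(X))(\Gamma)\vdash_{\Sigma[X]}\mathsf{Sen}^\alpha(\Sigma(X))(\Delta)$ infer $\{\exists X\cdot\phi\}\cup\Gamma\vdash_\Sigma\Delta$; ($\exists_R$) from $\Gamma\vdash_\Sigma\Delta\cup\{\mathsf{Sen}^\alpha(\theta)(\phi)\}$, where $\theta$ is a $\Sigma(X)$-substitution, infer $\Gamma\vdash_\Sigma\Delta\cup\{\exists X\cdot\phi\}$. -}

module Defs where

open import Level using (Level; suc; _⊔_)
open import Data.Nat using (ℕ)
open import Data.Fin using (Fin)
open import Data.Product using (Σ; _×_; _,_; ∃)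
open import Data.Empty using (⊥)
open import Relation.Nullary using (¬_)
open import Relation.Binary.PropositionalEquality using (_≡_; subst; subst₂)
open import Relation.Unary using (Pred; _∪_; _⊆_; ｛_｝)
open import Function.Bundles using (_⇔_; _↔_)

record DeltaInstitution (ℓ : Level) : Set (suc ℓ) where
  infixr 9 _∘_
  field
    Sig   : Set ℓ
    Hom   : Sig → Sig → Set ℓ
    _∘_   : ∀ {A B C} → Hom B C → Hom A B → Hom A C
    idH   : ∀ {A} → Hom A A
    assoc : ∀ {A B C D} (h : Hom C D) (g : Hom B C) (f : Hom A B) →
            (h ∘ g) ∘ f ≡ h ∘ (g ∘ f)
    idˡ   : ∀ {A B} (f : Hom A B) → idH ∘ f ≡ f
    idʳ   : ∀ {A B} (f : Hom A B) → f ∘ idH ≡ f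

    -- Mod : Sig^op → CAT (object part; reducts)
    Mod       : Sig → Set ℓ
    reduct    : ∀ {S S'} → Hom S S' → Mod S' → Mod S
    reduct-id : ∀ {S} (M : Mod S) → reduct idH M ≡ M
    reduct-∘  : ∀ {S S' S''} (g : Hom S' S'') (f : Hom S S') (M : Mod S'') →
                reduct (g ∘ f) M ≡ reduct f (reduct g M)

    Sen    : Sig → Set ℓ
    sen    : ∀ {S S'} → Hom S S' → Sen S → Sen S'
    sen-id : ∀ {S} (e : Sen S) → sen idH e ≡ e
    sen-∘  : ∀ {S S' S''} (g : Hom S' S'') (f : Hom S S') (e : Sen S) →
             sen (g ∘ f) e ≡ sen g (sen f e)

    _⊨_      : ∀ {S} → Mod S → Sen S → Set ℓ
    sat-cond : ∀ {S S'} (χ : Hom S S') (M' : Mod S') (e : Sen S) →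
               (reduct χ M' ⊨ e) ⇔ (M' ⊨ sen χ e)

    -- (i) the functor (·)_Δ : Sig → Cat
    Block  : Sig → Set ℓ
    BHom   : ∀ {S} → Block S → Block S → Set ℓ
    _∘B_   : ∀ {S} {X Y Z : Block S} → BHom Y Z → BHom X Y → BHom X Z
    idB    : ∀ {S} {X : Block S} → BHom X X
    assocB : ∀ {S} {X Y Z W : Block S} (h : BHom Z W) (g : BHom Y Z) (f : BHom X Y) →
             (h ∘B g) ∘B f ≡ h ∘B (g ∘B f)
    idBˡ   : ∀ {S} {X Y : Block S} (f : BHom X Y) → idB ∘B f ≡ f
    idBʳ   : ∀ {S} {X Y : Block S} (f : BHom X Y) → f ∘B idB ≡ f
    Δ₀     : ∀ {S S'} → Hom S S' → Block S → Block S'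
    Δ₁     : ∀ {S S'} (χ : Hom S S') {X Y : Block S} → BHom X Y → BHom (Δ₀ χ X) (Δ₀ χ Y)
    Δ₁-id  : ∀ {S S'} (χ : Hom S S') {X : Block S} → Δ₁ χ (idB {X = X}) ≡ idB
    Δ₁-∘   : ∀ {S S'} (χ : Hom S S') {X Y Z : Block S} (g : BHom Y Z) (f : BHom X Y) →
             Δ₁ χ (g ∘B f) ≡ Δ₁ χ g ∘B Δ₁ χ f
    Δ₀-id  : ∀ {S} (X : Block S) → Δ₀ idH X ≡ X
    Δ₀-∘   : ∀ {S S' S''} (g : Hom S' S'') (f : Hom S S') (X : Block S) →
             Δ₀ (g ∘ f) X ≡ Δ₀ g (Δ₀ f X)
    Δ₁-idH : ∀ {S} {X Y : Block S} (ι : BHom X Y) →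
             subst₂ BHom (Δ₀-id X) (Δ₀-id Y) (Δ₁ idH ι) ≡ ι
    Δ₁-∘H  : ∀ {S S' S''} (g : Hom S' S'') (f : Hom S S') {X Y : Block S} (ι : BHom X Y) →
             subst₂ BHom (Δ₀-∘ g f X) (Δ₀-∘ g f Y) (Δ₁ (g ∘ f) ι) ≡ Δ₁ g (Δ₁ f ι)

    -- (ii) Σ(X) : Σ → Σ[X] and Σ[ι] : Σ[X] → Σ[Y]
    Ext     : (S : Sig) → Block S → Sig
    inj     : ∀ {S} (X : Block S) → Hom S (Ext S X)
    ext     : ∀ {S} {X Y : Block S} → BHom X Y → Hom (Ext S X) (Ext S Y)
    ext-inj : ∀ {S} {X Y : Block S} (ι : BHom X Y) → ext ι ∘ inj X ≡ inj Y
    ext-id  : ∀ {S} {X : Block S} → ext (idB {X = X}) ≡ idH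
    ext-∘   : ∀ {S} {X Y Z : Block S} (g : BHom Y Z) (f : BHom X Y) →
              ext (g ∘B f) ≡ ext g ∘ ext f

    -- (iii) χ[X] : Σ[X] → Σ'[χ_Δ(X)]
    lift     : ∀ {S S'} (χ : Hom S S') (X : Block S) → Hom (Ext S X) (Ext S' (Δ₀ χ X))
    lift-inj : ∀ {S S'} (χ : Hom S S') (X : Block S) →
               lift χ X ∘ inj X ≡ inj (Δ₀ χ X) ∘ χ
    lift-ext : ∀ {S S'} (χ : Hom S S') {X Y : Block S} (ι : BHom X Y) →
               lift χ Y ∘ ext ι ≡ ext (Δ₁ χ ι) ∘ lift χ X
    lift-id  : ∀ {S} (X : Block S) →
               subst (λ Z → Hom (Ext S X) (Ext S Z)) (Δ₀-id X) (lift idH X) ≡ idH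
    lift-∘   : ∀ {S S' S''} (g : Hom S' S'') (f : Hom S S') (X : Block S) →
               subst (λ Z → Hom (Ext S X) (Ext S'' Z)) (Δ₀-∘ g f X) (lift (g ∘ f) X)
                 ≡ lift g (Δ₀ f X) ∘ lift f X

    lift-univ : ∀ {S S' S''} (χ : Hom S S') (X : Block S)
                (τ : Hom S' S'') (σ : Hom (Ext S X) S'') → σ ∘ inj X ≡ τ ∘ χ →
                Σ (Hom (Ext S' (Δ₀ χ X)) S'') λ u →
                  ((u ∘ inj (Δ₀ χ X) ≡ τ) × (u ∘ lift χ X ≡ σ)) ×
                  (∀ (u' : Hom (Ext S' (Δ₀ χ X)) S'') →
                     u' ∘ inj (Δ₀ χ X) ≡ τ → u' ∘ lift χ X ≡ σ → u' ≡ u)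

    lift-exp : ∀ {S S'} (χ : Hom S S') (M' : Mod S') (X : Block S)
               (N : Mod (Ext S X)) → reduct (inj X) N ≡ reduct χ M' →
               Σ (Mod (Ext S' (Δ₀ χ X))) λ N' →
                 ((reduct (inj (Δ₀ χ X)) N' ≡ M') × (reduct (lift χ X) N' ≡ N)) ×
                 (∀ (N'' : Mod (Ext S' (Δ₀ χ X))) →
                    reduct (inj (Δ₀ χ X)) N'' ≡ M' → reduct (lift χ X) N'' ≡ N → N'' ≡ N')

-- An infinite cardinal α, presented by the collection of its members
-- (the index sets N ∈ α allowed for disjunctions); infinite: every
-- finite cardinal is a member.

record InfCard (ℓ : Level) : Set (suc ℓ) where
  field
    Ix       : Set ℓ
    El       : Ix → Set ℓ
    infinite : ∀ (n : ℕ) → Σ Ix λ i → El i ↔ Fin n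

module FOL {ℓ : Level} (I : DeltaInstitution ℓ) (α : InfCard ℓ) where
  open DeltaInstitution I
  open InfCard α

  data SenA : Sig → Set ℓ where
    atom : ∀ {S} → Sen S → SenA S
    neg  : ∀ {S} → SenA S → SenA S
    disj : ∀ {S} (N : Ix) → (El N → SenA S) → SenA S
    ex   : ∀ {S} (X : Block S) → SenA (Ext S X) → SenA S

  senA : ∀ {S S'} → Hom S S' → SenA S → SenA S'
  senA χ (atom e)   = atom (sen χ e)
  senA χ (neg φ)    = neg (senA χ φ)
  senA χ (disj N φ) = disj N (λ n → senA χ (φ n))
  senA χ (ex X φ)   = ex (Δ₀ χ X) (senA (lift χ X) φ)

  Expansion : ∀ {S} (X : Block S) → Mod S → Set ℓ
  Expansion {S} X M = Σ (Mod (Ext S X)) λ N → reduct (inj X) N ≡ M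

  _⊨A_ : ∀ {S} → Mod S → SenA S → Set ℓ
  M ⊨A atom e   = M ⊨ e
  M ⊨A neg φ    = ¬ (M ⊨A φ)
  M ⊨A disj N φ = Σ (El N) λ n → M ⊨A φ n
  _⊨A_ {S} M (ex X φ) = Σ (Mod (Ext S X)) λ N → (reduct (inj X) N ≡ M) × (N ⊨A φ)

  SemA : (S : Sig) → Pred (SenA S) ℓ → Pred (SenA S) ℓ → Set ℓ
  SemA S Γ Δ = ¬ (Σ (Mod S) λ M → (∀ φ → Γ φ → M ⊨A φ) × (∀ φ → Δ φ → ¬ (M ⊨A φ)))

  SemI : (S : Sig) → Pred (Sen S) ℓ → Pred (Sen S) ℓ → Set ℓ
  SemI S Γ Δ = ¬ (Σ (Mod S) λ M → (∀ e → Γ e → M ⊨ e) × (∀ e → Δ e → ¬ (M ⊨ e)))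

  image : ∀ {A B : Set ℓ} → (A → B) → Pred A ℓ → Pred B ℓ
  image f Γ y = Σ _ λ x → Γ x × f x ≡ y

  ⋃[_] : ∀ {A : Set ℓ} (N : Ix) → (El N → Pred A ℓ) → Pred A ℓ
  ⋃[ N ] F x = Σ (El N) λ n → F n x

  data Deriv : (S : Sig) → Pred (SenA S) ℓ → Pred (SenA S) ℓ → Set (suc ℓ) where
    modify : ∀ {S S'} (χ : Hom S S') {Γ Δ : Pred (SenA S) ℓ} {Γ' Δ' : Pred (SenA S') ℓ} →
             Deriv S Γ Δ → image (senA χ) Γ ⊆ Γ' → image (senA χ) Δ ⊆ Δ' →
             Deriv S' Γ' Δ'
    init   : ∀ {S} (ψ : SenA S) (Γ Δ : Pred (SenA S) ℓ) →
             Deriv S (｛ ψ ｝ ∪ Γ) (Δ ∪ ｛ ψ ｝)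
    cut    : ∀ {S} (ψ : SenA S) {Γ Δ Γ' Δ' : Pred (SenA S) ℓ} →
             Deriv S Γ (Δ ∪ ｛ ψ ｝) → Deriv S (｛ ψ ｝ ∪ Γ') Δ' →
             Deriv S (Γ ∪ Γ') (Δ ∪ Δ')
    atomR  : ∀ {S} (Γb Δb : Pred (Sen S) ℓ) (Γ Δ : Pred (SenA S) ℓ) →
             SemI S Γb Δb →
             Deriv S (image atom Γb ∪ Γ) (Δ ∪ image atom Δb)
    negL   : ∀ {S} (φ : SenA S) {Γ Δ : Pred (SenA S) ℓ} →
             Deriv S Γ (Δ ∪ ｛ φ ｝) → Deriv S (｛ neg φ ｝ ∪ Γ) Δ
    negR   : ∀ {S} (φ : SenA S) {Γ Δ : Pred (SenA S) ℓ} →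
             Deriv S (｛ φ ｝ ∪ Γ) Δ → Deriv S Γ (Δ ∪ ｛ neg φ ｝)
    disjL  : ∀ {S} (N : Ix) (φ : El N → SenA S) (Γs Δs : El N → Pred (SenA S) ℓ) →
             (∀ n → Deriv S (｛ φ n ｝ ∪ Γs n) (Δs n)) →
             Deriv S (｛ disj N φ ｝ ∪ ⋃[ N ] Γs) (⋃[ N ] Δs)
    disjR  : ∀ {S} (N : Ix) (φ : El N → SenA S) (n : El N) {Γ Δ : Pred (SenA S) ℓ} →
             Deriv S Γ (Δ ∪ ｛ φ n ｝) → Deriv S Γ (Δ ∪ ｛ disj N φ ｝)
    exL    : ∀ {S} (X : Block S) (φ : SenA (Ext S X)) {Γ Δ : Pred (SenA S) ℓ} →
             Deriv (Ext S X) (｛ φ ｝ ∪ image (senA (inj X)) Γ) (image (senA (inj X)) Δ) →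
             Deriv S (｛ ex X φ ｝ ∪ Γ) Δ
    exR    : ∀ {S} (X : Block S) (φ : SenA (Ext S X)) (θ : Hom (Ext S X) S) →
             θ ∘ inj X ≡ idH → {Γ Δ : Pred (SenA S) ℓ} →
             Deriv S Γ (Δ ∪ ｛ senA θ φ ｝) → Deriv S Γ (Δ ∪ ｛ ex X φ ｝)

{-# OPTIONS --safe #-}
module Submission where

open import Level using (Level)
open import Relation.Unary using (Pred; _⊆_; _∪_; ｛_｝)
open import Defs
open import Data.Product using (_,_; map₂)
open import Data.Sum using (inj₁; inj₂)
open import Function using (_∘′_)
open import Function.Bundles using (_⇔_; mk⇔; Equivalence)
open import Function.Related.TypeIsomorphisms using (¬-cong-⇔)
open import Relation.Nullary using (¬_)
open import Relation.Binary.PropositionalEquality using (_≡_; refl; sym; trans; cong)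
open import Relation.Binary.PropositionalEquality.Properties using (module ≡-Reasoning)

-- Soundness is checked rule by rule on a countermodel of the conclusion, which is turned
-- into a countermodel of a premise.  The one real ingredient is that the satisfaction
-- condition of I extends to all of FOL_α(I): for ∃ the expansion of a reduct lifts along
-- χ[X] by property (v), and an expansion reducts back along the square χ[X] ∘ Σ(X) =
-- Σ'(χ_Δ X) ∘ χ.  For (∃_R), a Σ(X)-substitution θ makes reduct θ M an expansion of M.

module Soundness {ℓ : Level} (I : DeltaInstitution ℓ) (α : InfCard ℓ) where
  open DeltaInstitution I
  open FOL I α
  open Equivalence using (to; from)

  reduct-square : ∀ {A B C D} {f : Hom A B} {g : Hom B D} {f' : Hom A C} {g' : Hom C D} →
                  g ∘ f ≡ g' ∘ f' → ∀ M → reduct f (reduct g M) ≡ reduct f' (reduct g' M)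
  reduct-square {f = f} {g} {f'} {g'} square M = begin
    reduct f (reduct g M)    ≡⟨ sym (reduct-∘ g f M) ⟩
    reduct (g ∘ f) M         ≡⟨ cong (λ h → reduct h M) square ⟩
    reduct (g' ∘ f') M       ≡⟨ reduct-∘ g' f' M ⟩
    reduct f' (reduct g' M)  ∎
    where open ≡-Reasoning

  reduct-retraction : ∀ {A B} {ι : Hom A B} {θ : Hom B A} →
                      θ ∘ ι ≡ idH → ∀ M → reduct ι (reduct θ M) ≡ M
  reduct-retraction {ι = ι} {θ} retraction M = begin
    reduct ι (reduct θ M)  ≡⟨ sym (reduct-∘ θ ι M) ⟩
    reduct (θ ∘ ι) M       ≡⟨ cong (λ h → reduct h M) retraction ⟩
    reduct idH M           ≡⟨ reduct-id M ⟩
    M                      ∎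
    where open ≡-Reasoning

  satA-cond : ∀ {S S'} (χ : Hom S S') (M' : Mod S') (φ : SenA S) →
              reduct χ M' ⊨A φ ⇔ M' ⊨A senA χ φ
  satA-cond χ M' (atom e)   = sat-cond χ M' e
  satA-cond χ M' (neg φ)    = ¬-cong-⇔ (satA-cond χ M' φ)
  satA-cond χ M' (disj N φ) =
    mk⇔ (map₂ (to (satA-cond χ M' (φ _)))) (map₂ (from (satA-cond χ M' (φ _))))
  satA-cond χ M' (ex X φ)   = mk⇔ expand restrict
    where
    expand : reduct χ M' ⊨A ex X φ → M' ⊨A senA χ (ex X φ)
    expand (N , N-expands , N⊨φ) with lift-exp χ M' X N N-expands
    ... | N' , (N'-expands , refl) , _ = N' , N'-expands , to (satA-cond (lift χ X) N' φ) N⊨φ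

    restrict : M' ⊨A senA χ (ex X φ) → reduct χ M' ⊨A ex X φ
    restrict (N' , refl , N'⊨φ) =
      reduct (lift χ X) N' , reduct-square (lift-inj χ X) N' , from (satA-cond (lift χ X) N' φ) N'⊨φ

  Holds : ∀ {S} → Mod S → Pred (SenA S) ℓ → Set ℓ
  Holds M Γ = ∀ φ → Γ φ → M ⊨A φ

  Fails : ∀ {S} → Mod S → Pred (SenA S) ℓ → Set ℓ
  Fails M Δ = ∀ φ → Δ φ → ¬ M ⊨A φ

  module _ {S : Sig} {M : Mod S} where

    holds-mono : ∀ {Γ Γ'} → Γ ⊆ Γ' → Holds M Γ' → Holds M Γ
    holds-mono Γ⊆Γ' holds φ φ∈Γ = holds φ (Γ⊆Γ' φ∈Γ)

    fails-mono : ∀ {Δ Δ'} → Δ ⊆ Δ' → Fails M Δ' → Fails M Δ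
    fails-mono Δ⊆Δ' fails φ φ∈Δ = fails φ (Δ⊆Δ' φ∈Δ)

    holds-insert : ∀ {ψ Γ} → M ⊨A ψ → Holds M Γ → Holds M (｛ ψ ｝ ∪ Γ)
    holds-insert M⊨ψ holds _ (inj₁ refl) = M⊨ψ
    holds-insert M⊨ψ holds φ (inj₂ φ∈Γ)  = holds φ φ∈Γ

    fails-insert : ∀ {ψ Δ} → ¬ M ⊨A ψ → Fails M Δ → Fails M (Δ ∪ ｛ ψ ｝)
    fails-insert M⊭ψ fails φ (inj₁ φ∈Δ) = fails φ φ∈Δ
    fails-insert M⊭ψ fails _ (inj₂ refl) = M⊭ψ

  module _ {S S'} (χ : Hom S S') {M' : Mod S'} where

    holds-reduct : ∀ {Γ} → Holds M' (image (senA χ) Γ) → Holds (reduct χ M') Γ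
    holds-reduct holds φ φ∈Γ = from (satA-cond χ M' φ) (holds _ (φ , φ∈Γ , refl))

    fails-reduct : ∀ {Δ} → Fails M' (image (senA χ) Δ) → Fails (reduct χ M') Δ
    fails-reduct fails φ φ∈Δ = fails _ (φ , φ∈Δ , refl) ∘′ to (satA-cond χ M' φ)

    holds-image : ∀ {Γ} → Holds (reduct χ M') Γ → Holds M' (image (senA χ) Γ)
    holds-image holds _ (φ , φ∈Γ , refl) = to (satA-cond χ M' φ) (holds φ φ∈Γ)

    fails-image : ∀ {Δ} → Fails (reduct χ M') Δ → Fails M' (image (senA χ) Δ)
    fails-image fails _ (φ , φ∈Δ , refl) = fails φ φ∈Δ ∘′ from (satA-cond χ M' φ)

  sound : ∀ {S Γ Δ} → Deriv S Γ Δ → SemA S Γ Δ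
  sound (modify χ d image⊆Γ image⊆Δ) (M' , holds , fails) =
    sound d (reduct χ M' , holds-reduct χ (holds-mono image⊆Γ holds)
                         , fails-reduct χ (fails-mono image⊆Δ fails))
  sound (init ψ Γ Δ) (M , holds , fails) = fails ψ (inj₂ refl) (holds ψ (inj₁ refl))
  sound (cut ψ d₁ d₂) (M , holds , fails) =
    sound d₁ (M , holds-mono inj₁ holds , fails-insert M⊭ψ (fails-mono inj₁ fails))
    where
    M⊭ψ : ¬ M ⊨A ψ
    M⊭ψ M⊨ψ = sound d₂ (M , holds-insert M⊨ψ (holds-mono inj₂ holds) , fails-mono inj₂ fails)
  sound (atomR Γb Δb Γ Δ semI) (M , holds , fails) =
    semI (M , (λ e e∈Γb → holds (atom e) (inj₁ (e , e∈Γb , refl)))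
            , (λ e e∈Δb → fails (atom e) (inj₂ (e , e∈Δb , refl))))
  sound (negL φ d) (M , holds , fails) =
    sound d (M , holds-mono inj₂ holds , fails-insert (holds (neg φ) (inj₁ refl)) fails)
  sound (negR φ d) (M , holds , fails) =
    fails (neg φ) (inj₂ refl) λ M⊨φ → sound d (M , holds-insert M⊨φ holds , fails-mono inj₁ fails)
  sound (disjL N φ Γs Δs ds) (M , holds , fails) with holds (disj N φ) (inj₁ refl)
  ... | n , M⊨φₙ =
    sound (ds n) (M , holds-insert M⊨φₙ (holds-mono (inj₂ ∘′ (n ,_)) holds) , fails-mono (n ,_) fails)
  sound (disjR N φ n d) (M , holds , fails) =
    sound d (M , holds , fails-insert (λ M⊨φₙ → fails (disj N φ) (inj₂ refl) (n , M⊨φₙ))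
                                      (fails-mono inj₁ fails))
  sound (exL X φ d) (M , holds , fails) with holds (ex X φ) (inj₁ refl)
  ... | N , refl , N⊨φ =
    sound d (N , holds-insert N⊨φ (holds-image (inj X) (holds-mono inj₂ holds))
               , fails-image (inj X) fails)
  sound (exR X φ θ retraction d) (M , holds , fails) =
    sound d (M , holds , fails-insert M⊭θφ (fails-mono inj₁ fails))
    where
    M⊭θφ : ¬ M ⊨A senA θ φ
    M⊭θφ M⊨θφ = fails (ex X φ) (inj₂ refl)
      (reduct θ M , reduct-retraction retraction M , from (satA-cond θ M φ) M⊨θφ)

lemma4p5 : ∀ {ℓ : Level} (I : DeltaInstitution ℓ) (α : InfCard ℓ)
             (S : DeltaInstitution.Sig I)
             (Γ Δ : Pred (FOL.SenA I α S) ℓ) →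
             FOL.Deriv I α S Γ Δ → FOL.SemA I α S Γ Δ
lemma4p5 I α S Γ Δ = Soundness.sound I α
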